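{- For every positive integer $k$, $\mathcal{S}_k\subseteq k\text{ -funnels}$, $\mathcal{T}_k\subseteq k\text{ -funnels}$, and $k\text{ -funnels}\subseteq\mathcal{ST}_k$.
   Context: All graphs are DAGs without isolated vertices (standing assumption). A source (sink) is a vertex of in-degree (out-degree) $0$; a path is a sequence of distinct vertices joined consecutively by edges. For a vertex $v$, $\mu_s(v)$ is the number of paths from a source to $v$ and $\mu_t(v)$ the number of paths from $v$ to a sink. For an edge $e$, $\mu(e)$ is the number of source-to-sink paths containing $e$; $e$ is $k$-shared if $\mu(e)>k$ and $k$-private otherwise. A DAG is a $k$-funnel if no source-to-sink path uses only $k$-shared edges. A DAG $G=(V,E)$ is in $\mathcal{S}_k$ ($\mathcal{T}_k$) if $\mu_s(v)\le k$ ($\mu_t(v)\le k$) for all $v\in V$, and in $\mathcal{ST}_k$ if for every $v\in V$, $\mu_s(v)\le k$ or $\mu_t(v)\le k$. -}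

module Defs where

open import Data.Nat using (ℕ; zero; suc; _≤_; _<_)
open import Data.Bool using (Bool; true; false; _∧_; _∨_; not; T; T?)
open import Data.Fin using (Fin; _≟_)
open import Data.List using (List; []; _∷_; _++_; [_]; map; concatMap; concat; filter; length; allFin; applyUpTo)
open import Data.List.Relation.Unary.All using (All)
open import Data.Product using (_×_; _,_; ∃)
open import Data.Sum using (_⊎_)
open import Data.Empty using (⊥)
open import Relation.Nullary using (¬_)
open import Relation.Nullary.Decidable using (⌊_⌋)
open import Relation.Unary using (Pred)

allB : {A : Set} → (A → Bool) → List A → Bool
allB p [] = true
allB p (x ∷ xs) = p x ∧ allB p xs

record Graph (n : ℕ) : Set where
  field
    edge : Fin n → Fin n → Bool
open Graph public

module _ {n : ℕ} (G : Graph n) where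

  isWalk : List (Fin n) → Bool
  isWalk [] = true
  isWalk (x ∷ []) = true
  isWalk (x ∷ y ∷ rest) = edge G x y ∧ isWalk (y ∷ rest)

  Acyclic : Set
  Acyclic = ∀ (v : Fin n) (p : List (Fin n)) → T (isWalk (v ∷ p ++ [ v ])) → ⊥

  NoIsolated : Set
  NoIsolated = ∀ (v : Fin n) → ∃ λ (u : Fin n) → T (edge G u v) ⊎ T (edge G v u)

  IsDAG : Set
  IsDAG = Acyclic × NoIsolated

  isSource : Fin n → Bool
  isSource v = allB (λ u → not (edge G u v)) (allFin n)

  isSink : Fin n → Bool
  isSink v = allB (λ u → not (edge G v u)) (allFin n)

  elemB : Fin n → List (Fin n) → Bool
  elemB x [] = false
  elemB x (y ∷ ys) = ⌊ x ≟ y ⌋ ∨ elemB x ys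

  allDistinct : List (Fin n) → Bool
  allDistinct [] = true
  allDistinct (x ∷ xs) = not (elemB x xs) ∧ allDistinct xs

  isPath : List (Fin n) → Bool
  isPath [] = false
  isPath p@(_ ∷ _) = isWalk p ∧ allDistinct p

  lists : ℕ → List (List (Fin n))
  lists zero = [ [] ]
  lists (suc m) = concatMap (λ xs → map (_∷ xs) (allFin n)) (lists m)

  -- all paths (a path has at most n distinct vertices); each listed once
  paths : List (List (Fin n))
  paths = filter (λ p → T? (isPath p)) (concat (applyUpTo (λ i → lists (suc i)) n))

  startsAt : Fin n → List (Fin n) → Bool
  startsAt v [] = false
  startsAt v (x ∷ _) = ⌊ x ≟ v ⌋

  endsAt : Fin n → List (Fin n) → Bool
  endsAt v [] = false
  endsAt v (x ∷ []) = ⌊ x ≟ v ⌋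
  endsAt v (x ∷ y ∷ rest) = endsAt v (y ∷ rest)

  startsAtSource : List (Fin n) → Bool
  startsAtSource [] = false
  startsAtSource (x ∷ _) = isSource x

  endsAtSink : List (Fin n) → Bool
  endsAtSink [] = false
  endsAtSink (x ∷ []) = isSink x
  endsAtSink (x ∷ y ∷ rest) = endsAtSink (y ∷ rest)

  containsEdge : Fin n → Fin n → List (Fin n) → Bool
  containsEdge a b [] = false
  containsEdge a b (x ∷ []) = false
  containsEdge a b (x ∷ y ∷ rest) = (⌊ x ≟ a ⌋ ∧ ⌊ y ≟ b ⌋) ∨ containsEdge a b (y ∷ rest)

  count : (List (Fin n) → Bool) → ℕ
  count P = length (filter (λ p → T? (P p)) paths)

  μs : Fin n → ℕ
  μs v = count (λ p → startsAtSource p ∧ endsAt v p)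

  μt : Fin n → ℕ
  μt v = count (λ p → startsAt v p ∧ endsAtSink p)

  μ : Fin n → Fin n → ℕ
  μ a b = count (λ p → startsAtSource p ∧ endsAtSink p ∧ containsEdge a b p)

  edgesOf : List (Fin n) → List (Fin n × Fin n)
  edgesOf [] = []
  edgesOf (x ∷ []) = []
  edgesOf (x ∷ y ∷ rest) = (x , y) ∷ edgesOf (y ∷ rest)

  Shared : ℕ → Fin n × Fin n → Set
  Shared k (a , b) = k < μ a b

  IsSTPath : List (Fin n) → Set
  IsSTPath p = T (isPath p) × T (startsAtSource p) × T (endsAtSink p)

  IsFunnel : ℕ → Set
  IsFunnel k = ∀ (p : List (Fin n)) → IsSTPath p → ¬ All (Shared k) (edgesOf p)

  InS : ℕ → Set
  InS k = ∀ (v : Fin n) → μs v ≤ k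

  InT : ℕ → Set
  InT k = ∀ (v : Fin n) → μt v ≤ k

  InST : ℕ → Set
  InST k = ∀ (v : Fin n) → μs v ≤ k ⊎ μt v ≤ k

{-# OPTIONS --safe #-}
-- If every vertex has at most k paths from a source, look at the last edge a → b of a
-- source-to-sink path: b is a sink, so every source-to-sink path through a → b is a
-- source-to-b path, whence μ(a → b) ≤ μ_s(b) ≤ k and the edge is k-private.  Dually for
-- the first edge when every μ_t ≤ k.  Conversely, if μ_s(v) > k and μ_t(v) > k, join a
-- source-to-v path P with a v-to-sink path Q (a path, by acyclicity).  Prefixing P
-- injects the v-to-sink paths into the source-to-sink paths through any edge of P, so
-- every edge of P has μ ≥ μ_t(v) > k; dually every edge of Q has μ ≥ μ_s(v) > k, and
-- P Q is a source-to-sink path of k-shared edges.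
module Submission where

open import Defs
open import Data.Bool using (Bool; true; false; _∧_; not; T; T?)
open import Data.Bool.Properties using (T-∧; T-∨)
open import Data.Empty using (⊥-elim)
open import Data.Fin using (Fin; _≟_)
open import Data.List
  using (List; []; _∷_; _++_; [_]; map; concat; concatMap; filter; length; allFin; applyUpTo; cartesianProductWith)
open import Data.List.Properties
  using (++-assoc; ++-cancelˡ; ++-cancelʳ; ++-conicalʳ; ∷-injective; length-map; length-++-sucʳ; length-tabulate)
open import Data.List.Membership.Propositional using (_∈_; _∉_)
open import Data.List.Membership.Propositional.Properties
  using (∈-∃++; ∈-++⁺ˡ; ∈-++⁺ʳ; ∈-++⁻; ∈-allFin; ∈-filter⁺; ∈-filter⁻; ∈-map⁻;
         ∈-concat⁺′; ∈-applyUpTo⁺; ∈-cartesianProductWith⁺; ∈-cartesianProductWith⁻)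
open import Data.List.Relation.Binary.Subset.Propositional using (_⊆_)
open import Data.List.Relation.Unary.All as All using (All; []; _∷_)
open import Data.List.Relation.Unary.All.Properties using (¬Any⇒All¬; All¬⇒¬Any; applyUpTo⁺₂)
import Data.List.Relation.Unary.AllPairs.Properties as AllPairs
open import Data.List.Relation.Unary.Any using (here; there)
open import Data.List.Relation.Unary.Unique.Propositional using (Unique; []; _∷_)
import Data.List.Relation.Unary.Unique.Propositional.Properties as Unique
open import Data.Nat using (ℕ; suc; _≤_; _<_; z≤n; s≤s; _≤?_)
open import Data.Nat.Properties
  using (≤-trans; ≤-<-trans; <-≤-trans; <⇒≱; <⇒≢; ≰⇒>; module ≤-Reasoning)
open import Data.Product using (_×_; _,_; proj₁; proj₂; ∃; ∃₂; swap)
open import Data.Sum using (inj₁; inj₂; [_,_]′)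
open import Function using (_∘_; id)
open import Function.Bundles using (Equivalence)
open import Relation.Binary.PropositionalEquality using (_≡_; refl; sym; trans; cong; cong₂; subst)
open import Relation.Nullary using (¬_; yes; no)
open import Relation.Nullary.Decidable using (⌊_⌋; toWitness; fromWitness)

open Equivalence using (to; from)

Unique⇒length≤ : {A : Set} {xs ys : List A} → Unique xs → xs ⊆ ys → length xs ≤ length ys
Unique⇒length≤ {xs = []} _ _ = z≤n
Unique⇒length≤ {xs = x ∷ xs} (x∉xs ∷ xs-unique) xs⊆ys with ∈-∃++ (xs⊆ys (here refl))
... | pre , post , refl = begin
    suc (length xs)            ≤⟨ s≤s (Unique⇒length≤ xs-unique xs⊆pre++post) ⟩
    suc (length (pre ++ post)) ≡⟨ sym (length-++-sucʳ pre x post) ⟩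
    length (pre ++ x ∷ post)   ∎
  where
    open ≤-Reasoning
    xs⊆pre++post : xs ⊆ pre ++ post
    xs⊆pre++post {z} z∈xs with ∈-++⁻ pre (xs⊆ys (there z∈xs))
    ... | inj₁ z∈pre          = ∈-++⁺ˡ z∈pre
    ... | inj₂ (here refl)    = ⊥-elim (All.lookup x∉xs z∈xs refl)
    ... | inj₂ (there z∈post) = ∈-++⁺ʳ pre z∈post

concatMap-map≡cartesianProductWith : {A B C : Set} (f : A → B → C) (xs : List A) (ys : List B) →
  concatMap (λ x → map (f x) ys) xs ≡ cartesianProductWith f xs ys
concatMap-map≡cartesianProductWith f []       ys = refl
concatMap-map≡cartesianProductWith f (x ∷ xs) ys =
  cong (map (f x) ys ++_) (concatMap-map≡cartesianProductWith f xs ys)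

0<length⇒∃∈ : {A : Set} {xs : List A} → 0 < length xs → ∃ (_∈ xs)
0<length⇒∃∈ {xs = x ∷ _} _ = x , here refl

T-not⇒¬T : ∀ {b} → T (not b) → ¬ T b
T-not⇒¬T {false} _ ()

¬T⇒T-not : ∀ {b} → ¬ T b → T (not b)
¬T⇒T-not {false} _  = _
¬T⇒T-not {true}  ¬b = ¬b _

allB-∈ : {A : Set} {p : A → Bool} {xs : List A} {x : A} → T (allB p xs) → x ∈ xs → T (p x)
allB-∈ all (here refl)  = proj₁ (to T-∧ all)
allB-∈ all (there x∈xs) = allB-∈ (proj₂ (to T-∧ all)) x∈xs

module _ {n : ℕ} (G : Graph n) where

  source-no-edge-in : ∀ {u v} → T (isSource G v) → ¬ T (edge G u v)
  source-no-edge-in {u} src = T-not⇒¬T (allB-∈ src (∈-allFin u))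

  sink-no-edge-out : ∀ {u v} → T (isSink G v) → ¬ T (edge G v u)
  sink-no-edge-out {u} snk = T-not⇒¬T (allB-∈ snk (∈-allFin u))

  ¬source×sink : NoIsolated G → ∀ {v} → T (isSource G v) → ¬ T (isSink G v)
  ¬source×sink no-isolated {v} src snk with no-isolated v
  ... | u , inj₁ u→v = source-no-edge-in src u→v
  ... | u , inj₂ v→u = sink-no-edge-out snk v→u

  isWalk-tail : ∀ x p → T (isWalk G (x ∷ p)) → T (isWalk G p)
  isWalk-tail x []      _ = _
  isWalk-tail x (y ∷ p) w = proj₂ (to T-∧ w)

  isWalk-++⁻ˡ : ∀ p q → T (isWalk G (p ++ q)) → T (isWalk G p)
  isWalk-++⁻ˡ []          q _ = _
  isWalk-++⁻ˡ (x ∷ [])    q _ = _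
  isWalk-++⁻ˡ (x ∷ y ∷ p) q w =
    from T-∧ (proj₁ (to T-∧ w) , isWalk-++⁻ˡ (y ∷ p) q (proj₂ (to T-∧ w)))

  isWalk-++⁺ : ∀ i v t → T (isWalk G (i ++ [ v ])) → T (isWalk G (v ∷ t)) → T (isWalk G (i ++ v ∷ t))
  isWalk-++⁺ []          v t _  w = w
  isWalk-++⁺ (x ∷ [])    v t w₁ w = from T-∧ (proj₁ (to T-∧ w₁) , w)
  isWalk-++⁺ (x ∷ y ∷ i) v t w₁ w =
    from T-∧ (proj₁ (to T-∧ w₁) , isWalk-++⁺ (y ∷ i) v t (proj₂ (to T-∧ w₁)) w)

  -- A repeated vertex x ∷ mid ++ x ∷ post would give the closed walk x ∷ mid ++ [ x ].
  acyclic⇒isWalk⇒Unique : Acyclic G → ∀ p → T (isWalk G p) → Unique p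
  acyclic⇒isWalk⇒Unique acyclic []      _ = []
  acyclic⇒isWalk⇒Unique acyclic (x ∷ p) w =
    ¬Any⇒All¬ p x∉p ∷ acyclic⇒isWalk⇒Unique acyclic p (isWalk-tail x p w)
    where
      x∉p : x ∉ p
      x∉p x∈p with ∈-∃++ x∈p
      ... | mid , post , refl = acyclic x mid (isWalk-++⁻ˡ (x ∷ mid ++ [ x ]) post
        (subst (T ∘ isWalk G ∘ (x ∷_)) (sym (++-assoc mid [ x ] post)) w))

  elemB⇒∈ : ∀ {x} xs → T (elemB G x xs) → x ∈ xs
  elemB⇒∈ (y ∷ ys) x∈ with to T-∨ x∈
  ... | inj₁ x≡y  = here (toWitness x≡y)
  ... | inj₂ x∈ys = there (elemB⇒∈ ys x∈ys)

  ∈⇒elemB : ∀ {x xs} → x ∈ xs → T (elemB G x xs)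
  ∈⇒elemB {x} (here refl)  = from T-∨ (inj₁ (fromWitness {a? = x ≟ x} refl))
  ∈⇒elemB     (there x∈xs) = from T-∨ (inj₂ (∈⇒elemB x∈xs))

  allDistinct⇒Unique : ∀ p → T (allDistinct G p) → Unique p
  allDistinct⇒Unique []      _ = []
  allDistinct⇒Unique (x ∷ p) d with to T-∧ d
  ... | x∉p , d′ = ¬Any⇒All¬ p (T-not⇒¬T x∉p ∘ ∈⇒elemB) ∷ allDistinct⇒Unique p d′

  Unique⇒allDistinct : ∀ {p} → Unique p → T (allDistinct G p)
  Unique⇒allDistinct []                  = _
  Unique⇒allDistinct {x ∷ p} (x∉p ∷ p-unique) =
    from T-∧ (¬T⇒T-not (All¬⇒¬Any x∉p ∘ elemB⇒∈ p) , Unique⇒allDistinct p-unique)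

  isPath⇒isWalk : ∀ p → T (isPath G p) → T (isWalk G p)
  isPath⇒isWalk (x ∷ p) path = proj₁ (to (T-∧ {isWalk G (x ∷ p)}) path)

  isPath⇒Unique : ∀ p → T (isPath G p) → Unique p
  isPath⇒Unique (x ∷ p) path = allDistinct⇒Unique (x ∷ p) (proj₂ (to (T-∧ {isWalk G (x ∷ p)}) path))

  acyclic⇒isWalk⇒isPath : Acyclic G → ∀ p → T (isWalk G p) → ¬ p ≡ [] → T (isPath G p)
  acyclic⇒isWalk⇒isPath acyclic []      _ p≢[] = ⊥-elim (p≢[] refl)
  acyclic⇒isWalk⇒isPath acyclic (x ∷ p) w _    =
    from T-∧ (w , Unique⇒allDistinct (acyclic⇒isWalk⇒Unique acyclic (x ∷ p) w))

  ∈-tail⇒edge-in : ∀ {v} x p → T (isWalk G (x ∷ p)) → v ∈ p → ∃ λ u → T (edge G u v)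
  ∈-tail⇒edge-in x (y ∷ p) w (here refl)  = x , proj₁ (to T-∧ w)
  ∈-tail⇒edge-in x (y ∷ p) w (there v∈p) = ∈-tail⇒edge-in y p (proj₂ (to T-∧ w)) v∈p

  isWalk-through-source⇒startsAt : ∀ {v} p → T (isWalk G p) → T (isSource G v) → v ∈ p →
    T (startsAt G v p)
  isWalk-through-source⇒startsAt {v} (x ∷ p) w src (here refl) = fromWitness {a? = v ≟ v} refl
  isWalk-through-source⇒startsAt     (x ∷ p) w src (there v∈p) =
    ⊥-elim (source-no-edge-in src (proj₂ (∈-tail⇒edge-in x p w v∈p)))

  isWalk-through-sink⇒endsAt : ∀ {v} p → T (isWalk G p) → T (isSink G v) → v ∈ p → T (endsAt G v p)
  isWalk-through-sink⇒endsAt {v} (x ∷ [])    w snk (here refl) = fromWitness {a? = v ≟ v} refl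
  isWalk-through-sink⇒endsAt     (x ∷ y ∷ p) w snk (here refl) =
    ⊥-elim (sink-no-edge-out snk (proj₁ (to T-∧ w)))
  isWalk-through-sink⇒endsAt     (x ∷ y ∷ p) w snk (there v∈p) =
    isWalk-through-sink⇒endsAt (y ∷ p) (proj₂ (to T-∧ w)) snk v∈p

  startsAt⇒≡ : ∀ v p → T (startsAt G v p) → ∃ λ t → p ≡ v ∷ t
  startsAt⇒≡ v (x ∷ t) x≡v = t , cong (_∷ t) (toWitness x≡v)

  endsAt⇒≡ : ∀ v p → T (endsAt G v p) → ∃ λ i → p ≡ i ++ [ v ]
  endsAt⇒≡ v (x ∷ [])    x≡v = [] , cong [_] (toWitness x≡v)
  endsAt⇒≡ v (x ∷ y ∷ p) ends with endsAt⇒≡ v (y ∷ p) ends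
  ... | i , eq = x ∷ i , cong (x ∷_) eq

  startsAtSource-++ : ∀ i v t → T (startsAtSource G (i ++ [ v ])) → T (startsAtSource G (i ++ v ∷ t))
  startsAtSource-++ []      v t src = src
  startsAtSource-++ (x ∷ i) v t src = src

  endsAtSink-++ : ∀ i v t → T (endsAtSink G (v ∷ t)) → T (endsAtSink G (i ++ v ∷ t))
  endsAtSink-++ []          v t snk = snk
  endsAtSink-++ (x ∷ [])    v t snk = snk
  endsAtSink-++ (x ∷ y ∷ i) v t snk = endsAtSink-++ (y ∷ i) v t snk

  IsSTPath-++ : Acyclic G → ∀ i v t →
    T (isPath G (i ++ [ v ])) → T (startsAtSource G (i ++ [ v ])) →
    T (isPath G (v ∷ t)) → T (endsAtSink G (v ∷ t)) →
    IsSTPath G (i ++ v ∷ t)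
  IsSTPath-++ acyclic i v t P-path P-src Q-path Q-snk =
      acyclic⇒isWalk⇒isPath acyclic (i ++ v ∷ t)
        (isWalk-++⁺ i v t (isPath⇒isWalk (i ++ [ v ]) P-path) (isPath⇒isWalk (v ∷ t) Q-path))
        ((λ ()) ∘ ++-conicalʳ i (v ∷ t))
    , startsAtSource-++ i v t P-src
    , endsAtSink-++ i v t Q-snk

  ≟×≟⇒≡ : ∀ {a b} (x y : Fin n) → T (⌊ x ≟ a ⌋ ∧ ⌊ y ≟ b ⌋) → (a , b) ≡ (x , y)
  ≟×≟⇒≡ {a} {b} x y xy with to (T-∧ {⌊ x ≟ a ⌋}) xy
  ... | x≡a , y≡b = cong₂ _,_ (sym (toWitness {a? = x ≟ a} x≡a)) (sym (toWitness {a? = y ≟ b} y≡b))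

  containsEdge⇒∈edgesOf : ∀ {a b} p → T (containsEdge G a b p) → (a , b) ∈ edgesOf G p
  containsEdge⇒∈edgesOf {a} {b} (x ∷ y ∷ p) c =
    [ here ∘ ≟×≟⇒≡ x y , there ∘ containsEdge⇒∈edgesOf (y ∷ p) ]′
      (to (T-∨ {⌊ x ≟ a ⌋ ∧ ⌊ y ≟ b ⌋}) c)

  ∈edgesOf⇒containsEdge : ∀ {a b} p → (a , b) ∈ edgesOf G p → T (containsEdge G a b p)
  ∈edgesOf⇒containsEdge (x ∷ y ∷ p) (here refl) =
    from (T-∨ {⌊ x ≟ x ⌋ ∧ ⌊ y ≟ y ⌋}) (inj₁ (from (T-∧ {⌊ x ≟ x ⌋})
      (fromWitness {a? = x ≟ x} refl , fromWitness {a? = y ≟ y} refl)))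
  ∈edgesOf⇒containsEdge {a} {b} (x ∷ y ∷ p) (there e∈) =
    from (T-∨ {⌊ x ≟ a ⌋ ∧ ⌊ y ≟ b ⌋}) (inj₂ (∈edgesOf⇒containsEdge (y ∷ p) e∈))

  ∈edgesOf⇒∈ˡ : ∀ {a b} p → (a , b) ∈ edgesOf G p → a ∈ p
  ∈edgesOf⇒∈ˡ (x ∷ y ∷ p) (here refl) = here refl
  ∈edgesOf⇒∈ˡ (x ∷ y ∷ p) (there e∈) = there (∈edgesOf⇒∈ˡ (y ∷ p) e∈)

  ∈edgesOf⇒∈ʳ : ∀ {a b} p → (a , b) ∈ edgesOf G p → b ∈ p
  ∈edgesOf⇒∈ʳ (x ∷ y ∷ p) (here refl) = there (here refl)
  ∈edgesOf⇒∈ʳ (x ∷ y ∷ p) (there e∈) = there (∈edgesOf⇒∈ʳ (y ∷ p) e∈)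

  edgesOf-++ : ∀ i v t → edgesOf G (i ++ v ∷ t) ≡ edgesOf G (i ++ [ v ]) ++ edgesOf G (v ∷ t)
  edgesOf-++ []          v t = refl
  edgesOf-++ (x ∷ [])    v t = refl
  edgesOf-++ (x ∷ y ∷ i) v t = cong ((x , y) ∷_) (edgesOf-++ (y ∷ i) v t)

  isSTPathThrough : Fin n → Fin n → List (Fin n) → Bool
  isSTPathThrough a b p = startsAtSource G p ∧ endsAtSink G p ∧ containsEdge G a b p

  IsSTPath⇒isSTPathThrough : ∀ {a b p} → IsSTPath G p → (a , b) ∈ edgesOf G p →
    T (isPath G p) × T (isSTPathThrough a b p)
  IsSTPath⇒isSTPathThrough {p = p} (path , src , snk) e∈ =
    path , from T-∧ (src , from T-∧ (snk , ∈edgesOf⇒containsEdge p e∈))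

  lastEdge : ∀ {P : Fin n × Fin n → Set} x y p → All P (edgesOf G (x ∷ y ∷ p)) →
    T (endsAtSink G (x ∷ y ∷ p)) → ∃₂ λ a b → P (a , b) × T (isSink G b)
  lastEdge x y []      (Pxy ∷ []) snk = x , y , Pxy , snk
  lastEdge x y (z ∷ p) (_ ∷ Ps)   snk = lastEdge y z p Ps snk

  lists-suc : ∀ m → lists G (suc m) ≡ cartesianProductWith (λ xs x → x ∷ xs) (lists G m) (allFin n)
  lists-suc m = concatMap-map≡cartesianProductWith (λ xs x → x ∷ xs) (lists G m) (allFin n)

  ∈lists⇒length≡ : ∀ {xs} m → xs ∈ lists G m → length xs ≡ m
  ∈lists⇒length≡ 0       (here refl) = refl
  ∈lists⇒length≡ (suc m) xs∈
    with ∈-cartesianProductWith⁻ (λ xs x → x ∷ xs) (lists G m) (allFin n)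
           (subst (_ ∈_) (lists-suc m) xs∈)
  ... | ys , _ , ys∈ , _ , refl = cong suc (∈lists⇒length≡ m ys∈)

  ∈lists : ∀ xs → xs ∈ lists G (length xs)
  ∈lists []       = here refl
  ∈lists (x ∷ xs) = subst (_ ∈_) (sym (lists-suc (length xs)))
    (∈-cartesianProductWith⁺ (λ xs x → x ∷ xs) (∈lists xs) (∈-allFin x))

  lists-Unique : ∀ m → Unique (lists G m)
  lists-Unique 0       = [] ∷ []
  lists-Unique (suc m) = subst Unique (sym (lists-suc m))
    (Unique.cartesianProductWith⁺ (λ xs x → x ∷ xs) (swap ∘ ∷-injective)
      (lists-Unique m) (Unique.allFin⁺ n))

  paths-Unique : Unique (paths G)
  paths-Unique = Unique.filter⁺ (T? ∘ isPath G)
    (Unique.concat⁺ (applyUpTo⁺₂ _ n (lists-Unique ∘ suc))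
      (AllPairs.applyUpTo⁺₁ _ n (λ i<j _ (xs∈ , xs∈′) →
        <⇒≢ (s≤s i<j) (trans (sym (∈lists⇒length≡ _ xs∈)) (∈lists⇒length≡ _ xs∈′)))))

  ∈paths⇒isPath : ∀ {p} → p ∈ paths G → T (isPath G p)
  ∈paths⇒isPath = proj₂ ∘ ∈-filter⁻ (T? ∘ isPath G) {xs = concat (applyUpTo (lists G ∘ suc) n)}

  isPath⇒∈paths : ∀ p → T (isPath G p) → p ∈ paths G
  isPath⇒∈paths (x ∷ p) path =
    ∈-filter⁺ (T? ∘ isPath G) (∈-concat⁺′ (∈lists (x ∷ p)) (∈-applyUpTo⁺ _ length<n)) path
    where
      length<n : length p < n
      length<n = subst (suc (length p) ≤_) (length-tabulate id)
        (Unique⇒length≤ (isPath⇒Unique (x ∷ p) path) (λ {z} _ → ∈-allFin z))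

  count-≤-by-injection : (P Q : List (Fin n) → Bool) (f : List (Fin n) → List (Fin n)) →
    (∀ {p q} → f p ≡ f q → p ≡ q) →
    (∀ p → T (isPath G p) → T (P p) → T (isPath G (f p)) × T (Q (f p))) →
    count G P ≤ count G Q
  count-≤-by-injection P Q f f-injective P⇒Q = begin
    count G P         ≡⟨ sym (length-map f Ps) ⟩
    length (map f Ps) ≤⟨ Unique⇒length≤ fPs-unique fPs⊆Qs ⟩
    count G Q         ∎
    where
      open ≤-Reasoning
      Ps : List (List (Fin n))
      Ps = filter (T? ∘ P) (paths G)
      fPs-unique : Unique (map f Ps)
      fPs-unique = Unique.map⁺ f-injective (Unique.filter⁺ (T? ∘ P) paths-Unique)
      fPs⊆Qs : map f Ps ⊆ filter (T? ∘ Q) (paths G)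
      fPs⊆Qs fp∈ with ∈-map⁻ f fp∈
      ... | p , p∈Ps , refl with ∈-filter⁻ (T? ∘ P) p∈Ps
      ... | p∈paths , Pp with P⇒Q p (∈paths⇒isPath p∈paths) Pp
      ... | fp-path , Qfp = ∈-filter⁺ (T? ∘ Q) (isPath⇒∈paths (f p) fp-path) Qfp

  0<count⇒∃ : (P : List (Fin n) → Bool) → 0 < count G P → ∃ λ p → T (isPath G p) × T (P p)
  0<count⇒∃ P 0<count with 0<length⇒∃∈ 0<count
  ... | p , p∈ with ∈-filter⁻ (T? ∘ P) p∈
  ... | p∈paths , Pp = p , ∈paths⇒isPath p∈paths , Pp

  μ-into-sink≤μs : ∀ {a b} → T (isSink G b) → μ G a b ≤ μs G b
  μ-into-sink≤μs {a} {b} snk = count-≤-by-injection _ _ id id ends-at-b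
    where
      ends-at-b : ∀ q → T (isPath G q) → T (isSTPathThrough a b q) →
        T (isPath G q) × T (startsAtSource G q ∧ endsAt G b q)
      ends-at-b q q-path h with to (T-∧ {startsAtSource G q}) h
      ... | src , h′ with to (T-∧ {endsAtSink G q}) h′
      ... | _ , c = q-path , from T-∧ (src , isWalk-through-sink⇒endsAt q (isPath⇒isWalk q q-path) snk
                      (∈edgesOf⇒∈ʳ q (containsEdge⇒∈edgesOf q c)))

  μ-out-of-source≤μt : ∀ {a b} → T (isSource G a) → μ G a b ≤ μt G a
  μ-out-of-source≤μt {a} {b} src = count-≤-by-injection _ _ id id starts-at-a
    where
      starts-at-a : ∀ q → T (isPath G q) → T (isSTPathThrough a b q) →
        T (isPath G q) × T (startsAt G a q ∧ endsAtSink G q)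
      starts-at-a q q-path h with to (T-∧ {endsAtSink G q}) (proj₂ (to (T-∧ {startsAtSource G q}) h))
      ... | snk , c = q-path , from T-∧ (isWalk-through-source⇒startsAt q (isPath⇒isWalk q q-path) src
                         (∈edgesOf⇒∈ˡ q (containsEdge⇒∈edgesOf q c)) , snk)

  InS⇒IsFunnel : ∀ {k} → NoIsolated G → InS G k → IsFunnel G k
  InS⇒IsFunnel no-isolated _    (x ∷ []) (_ , src , snk) _ = ¬source×sink no-isolated src snk
  InS⇒IsFunnel no-isolated μs≤k (x ∷ y ∷ p) (_ , _ , snk) shared with lastEdge x y p shared snk
  ... | _ , b , k<μ , b-sink = <⇒≱ k<μ (≤-trans (μ-into-sink≤μs b-sink) (μs≤k b))

  InT⇒IsFunnel : ∀ {k} → NoIsolated G → InT G k → IsFunnel G k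
  InT⇒IsFunnel no-isolated _    (x ∷ []) (_ , src , snk) _ = ¬source×sink no-isolated src snk
  InT⇒IsFunnel no-isolated μt≤k (x ∷ y ∷ p) (_ , src , _) (k<μ ∷ _) =
    <⇒≱ k<μ (≤-trans (μ-out-of-source≤μt src) (μt≤k x))

  module _ (acyclic : Acyclic G) {i v t}
    (P-path : T (isPath G (i ++ [ v ]))) (P-src : T (startsAtSource G (i ++ [ v ])))
    (Q-path : T (isPath G (v ∷ t))) (Q-snk : T (endsAtSink G (v ∷ t))) where

    μt≤μ-on-prefix : ∀ {a b} → (a , b) ∈ edgesOf G (i ++ [ v ]) → μt G v ≤ μ G a b
    μt≤μ-on-prefix {a} {b} e∈P = count-≤-by-injection _ _ (i ++_) (++-cancelˡ i _ _) prefix-P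
      where
        prefix-P : ∀ q → T (isPath G q) → T (startsAt G v q ∧ endsAtSink G q) →
          T (isPath G (i ++ q)) × T (isSTPathThrough a b (i ++ q))
        prefix-P q q-path h with to T-∧ h
        ... | starts , snk with startsAt⇒≡ v q starts
        ... | t′ , refl = IsSTPath⇒isSTPathThrough (IsSTPath-++ acyclic i v t′ P-path P-src q-path snk)
                            (subst ((a , b) ∈_) (sym (edgesOf-++ i v t′)) (∈-++⁺ˡ e∈P))

    μs≤μ-on-suffix : ∀ {a b} → (a , b) ∈ edgesOf G (v ∷ t) → μs G v ≤ μ G a b
    μs≤μ-on-suffix {a} {b} e∈Q = count-≤-by-injection _ _ (_++ t) (++-cancelʳ t _ _) suffix-Q
      where
        suffix-Q : ∀ p → T (isPath G p) → T (startsAtSource G p ∧ endsAt G v p) →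
          T (isPath G (p ++ t)) × T (isSTPathThrough a b (p ++ t))
        suffix-Q p p-path h with to T-∧ h
        ... | src , ends with endsAt⇒≡ v p ends
        ... | i′ , refl rewrite ++-assoc i′ [ v ] t =
          IsSTPath⇒isSTPathThrough (IsSTPath-++ acyclic i′ v t p-path src Q-path Q-snk)
            (subst ((a , b) ∈_) (sym (edgesOf-++ i′ v t)) (∈-++⁺ʳ _ e∈Q))

    shared-through-heavy-vertex : ∀ {k} → k < μs G v → k < μt G v →
      All (Shared G k) (edgesOf G (i ++ v ∷ t))
    shared-through-heavy-vertex k<μs k<μt = All.tabulate λ {(a , b)} e∈ →
      [ <-≤-trans k<μt ∘ μt≤μ-on-prefix , <-≤-trans k<μs ∘ μs≤μ-on-suffix ]′
        (∈-++⁻ (edgesOf G (i ++ [ v ])) (subst ((a , b) ∈_) (edgesOf-++ i v t) e∈))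

  heavy-vertex⇒¬IsFunnel : ∀ {k v} → Acyclic G → k < μs G v → k < μt G v → ¬ IsFunnel G k
  heavy-vertex⇒¬IsFunnel {v = v} acyclic k<μs k<μt funnel
    with 0<count⇒∃ _ (≤-<-trans z≤n k<μs) | 0<count⇒∃ _ (≤-<-trans z≤n k<μt)
  ... | P , P-path , P-into | Q , Q-path , Q-from
    with to T-∧ P-into | to T-∧ Q-from
  ... | P-src , P-ends | Q-starts , Q-snk
    with endsAt⇒≡ v P P-ends | startsAt⇒≡ v Q Q-starts
  ... | i , refl | t , refl =
    funnel (i ++ v ∷ t) (IsSTPath-++ acyclic i v t P-path P-src Q-path Q-snk)
      (shared-through-heavy-vertex acyclic P-path P-src Q-path Q-snk k<μs k<μt)

  IsFunnel⇒InST : ∀ {k} → Acyclic G → IsFunnel G k → InST G k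
  IsFunnel⇒InST {k} acyclic funnel v with μs G v ≤? k | μt G v ≤? k
  ... | yes μs≤k | _        = inj₁ μs≤k
  ... | no _     | yes μt≤k = inj₂ μt≤k
  ... | no μs≰k  | no μt≰k  =
    ⊥-elim (heavy-vertex⇒¬IsFunnel acyclic (≰⇒> μs≰k) (≰⇒> μt≰k) funnel)

lemma21 : ∀ (k : ℕ) → 1 ≤ k → ∀ (n : ℕ) (G : Graph n) → IsDAG G →
    (InS G k → IsFunnel G k) × (InT G k → IsFunnel G k) × (IsFunnel G k → InST G k)
lemma21 k _ n G (acyclic , no-isolated) =
  InS⇒IsFunnel G no-isolated , InT⇒IsFunnel G no-isolated , IsFunnel⇒InST G acyclic
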